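{- For all integers $r \geq 3$, $t \geq r-2$ and $s \geq 0$, $$ c(r+s,t+s) \geq c(r,t)+ts+\binom{s+1}{2}. $$
   Context: All graphs are finite and simple. A graph is $K_r$-saturated if it contains no copy of $K_r$ but adding any new edge creates a copy of $K_r$. For integers $r\ge 3$, $t\ge r-2$, $c(r,t)=\max\{t|G|-e(G): G \text{ is } K_r\text{ -saturated with minimum degree } \delta(G)=t\}$ (this maximum is known to exist), where $|G|$ is the number of vertices and $e(G)$ the number of edges. -}

module Defs where

open import Data.Nat using (ℕ; zero; suc; _+_; _*_; _≤_; _<ᵇ_)
open import Data.Fin using (Fin; zero; suc; toℕ)
open import Data.Bool using (Bool; true; false; if_then_else_; _∧_; _∨_)
open import Data.Product using (Σ; ∃; _×_; _,_)
open import Data.Integer using (ℤ; +_; _-_)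
open import Relation.Binary.PropositionalEquality using (_≡_; _≢_)
open import Relation.Nullary using (¬_; does)
open import Data.Fin using (_≟_)
open import Function using (_∘_)
open import Function.Definitions using (Injective)

record Graph (n : ℕ) : Set where
  field
    adj   : Fin n → Fin n → Bool
    sym   : ∀ i j → adj i j ≡ adj j i
    irrefl : ∀ i → adj i i ≡ false
open Graph public

count : ∀ {n} → (Fin n → Bool) → ℕ
count {zero}  f = 0
count {suc n} f = (if f zero then 1 else 0) + count (f ∘ suc)

sumFin : ∀ {n} → (Fin n → ℕ) → ℕ
sumFin {zero}  f = 0
sumFin {suc n} f = f zero + sumFin (f ∘ suc)

order : ∀ {n} → Graph n → ℕ
order {n} _ = n

deg : ∀ {n} → Graph n → Fin n → ℕ
deg G i = count (adj G i)

edges : ∀ {n} → Graph n → ℕ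
edges G = sumFin λ i → count λ j → adj G i j ∧ (toℕ i <ᵇ toℕ j)

MinDegree : ∀ {n} → Graph n → ℕ → Set
MinDegree G t = (∀ i → t ≤ deg G i) × (∃ λ i → deg G i ≡ t)

HasCliqueRel : ∀ {n} → (Fin n → Fin n → Bool) → ℕ → Set
HasCliqueRel {n} a r =
  Σ (Fin r → Fin n) λ f → Injective _≡_ _≡_ f ×
    (∀ i j → i ≢ j → a (f i) (f j) ≡ true)

HasClique : ∀ {n} → Graph n → ℕ → Set
HasClique G r = HasCliqueRel (adj G) r

addEdgeAdj : ∀ {n} → Graph n → Fin n → Fin n → Fin n → Fin n → Bool
addEdgeAdj G u v x y =
  adj G x y ∨ ((does (x ≟ u) ∧ does (y ≟ v)) ∨ (does (x ≟ v) ∧ does (y ≟ u)))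

Saturated : ∀ {n} → ℕ → Graph n → Set
Saturated r G =
  (¬ HasClique G r) ×
  (∀ u v → u ≢ v → adj G u v ≡ false → HasCliqueRel (addEdgeAdj G u v) r)

deficiency : ∀ {n} → ℕ → Graph n → ℤ
deficiency t G = + (t * order G) - + edges G

{-# OPTIONS --safe #-}
-- Coning off a graph (adding one vertex adjacent to all others) turns a
-- K_r-saturated graph with minimum degree t into a K_(r+1)-saturated graph
-- with minimum degree t + 1: cliques of the cone are cliques of the base plus
-- possibly the apex.  Since the apex brings one vertex and n edges,
-- t|G| - e(G) grows by exactly t + 1.  Coning s times therefore adds
-- (t + 1) + ... + (t + s) = ts + C(s+1, 2), with equality.
module Submission where

open import Defs hiding (sym)
open import Data.Nat using (ℕ; _+_; _*_; _≤_; _<_; _∸_; zero; suc; s≤s; z≤n)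
open import Data.Nat.Combinatorics using (_C_; nCk+nC[k+1]≡[n+1]C[k+1]; nC1≡n)
import Data.Nat.Properties as ℕ
import Data.Nat.Tactic.RingSolver as ℕ-Solver
open import Data.Integer using (+_; _-_) renaming (_+_ to _+ℤ_; _≤_ to _≤ℤ_)
import Data.Integer.Properties as ℤ
import Data.Integer.Tactic.RingSolver as ℤ-Solver
open import Data.Product using (Σ; ∃; _×_; _,_)
open import Data.Bool using (Bool; true; false)
open import Data.Fin using (Fin; zero; suc; punchIn; punchOut; _≟_)
open import Data.Fin.Properties
  using (any?; suc-injective; punchIn-injective; punchInᵢ≢i; punchOut-injective; punchIn-punchOut)
open import Function using (_∘_)
open import Function.Definitions using (Injective)
open import Relation.Nullary using (yes; no; contradiction)
open import Relation.Binary.PropositionalEquality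

count-true : ∀ n → count {n} (λ _ → true) ≡ n
count-true zero    = refl
count-true (suc n) = cong suc (count-true n)

count≤n : ∀ {n} (f : Fin n → Bool) → count f ≤ n
count≤n {zero}  f = z≤n
count≤n {suc n} f with f zero
... | true  = s≤s (count≤n (f ∘ suc))
... | false = ℕ.m≤n⇒m≤1+n (count≤n (f ∘ suc))

count<n : ∀ {n} (f : Fin n → Bool) (i : Fin n) → f i ≡ false → count f < n
count<n {suc n} f zero    fi≡false rewrite fi≡false = s≤s (count≤n (f ∘ suc))
count<n {suc n} f (suc i) fi≡false with f zero
... | true  = s≤s (count<n (f ∘ suc) i fi≡false)
... | false = ℕ.m≤n⇒m≤1+n (count<n (f ∘ suc) i fi≡false)

injective⇒all-but-one-≢ : ∀ {r m} (f : Fin (suc r) → Fin m) → Injective _≡_ _≡_ f →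
  (y : Fin m) → ∃ λ k → ∀ p → p ≢ k → f p ≢ y
injective⇒all-but-one-≢ f f-inj y with any? (λ p → f p ≟ y)
... | yes (k , fk≡y) = k , λ p p≢k fp≡y → p≢k (f-inj (trans fp≡y (sym fk≡y)))
... | no  ∄p         = zero , λ p _ fp≡y → ∄p (p , fp≡y)

deleteZero : ∀ {n} → (Fin (suc n) → Fin (suc n) → Bool) → Fin n → Fin n → Bool
deleteZero a x y = a (suc x) (suc y)

deleteZero-clique : ∀ {n r} (a : Fin (suc n) → Fin (suc n) → Bool) →
  HasCliqueRel a (suc r) → HasCliqueRel (deleteZero a) r
deleteZero-clique {n} {r} a (f , f-inj , f-clique)
  with injective⇒all-but-one-≢ f f-inj zero
... | k , f≢0 = g , g-inj , g-clique
  where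
  -- σ skips the only index whose image can be the vertex zero.
  σ : Fin r → Fin (suc r)
  σ = punchIn k

  σ-inj : Injective _≡_ _≡_ σ
  σ-inj = punchIn-injective k _ _

  0≢fσ : ∀ i → zero ≢ f (σ i)
  0≢fσ i 0≡fσi = f≢0 (σ i) (punchInᵢ≢i k i) (sym 0≡fσi)

  g : Fin r → Fin n
  g i = punchOut (0≢fσ i)

  suc-g : ∀ i → suc (g i) ≡ f (σ i)
  suc-g i = punchIn-punchOut (0≢fσ i)

  g-inj : Injective _≡_ _≡_ g
  g-inj {i} {j} gi≡gj = σ-inj (f-inj (punchOut-injective (0≢fσ i) (0≢fσ j) gi≡gj))

  g-clique : ∀ i j → i ≢ j → deleteZero a (g i) (g j) ≡ true
  g-clique i j i≢j = subst₂ (λ x y → a x y ≡ true) (sym (suc-g i)) (sym (suc-g j))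
    (f-clique (σ i) (σ j) (i≢j ∘ σ-inj))

apex-clique : ∀ {n r} (a : Fin (suc n) → Fin (suc n) → Bool) →
  (∀ x → a zero (suc x) ≡ true) → (∀ x → a (suc x) zero ≡ true) →
  HasCliqueRel (deleteZero a) r → HasCliqueRel a (suc r)
apex-clique {n} {r} a zero~ ~zero (f , f-inj , f-clique) = F , F-inj , F-clique
  where
  F : Fin (suc r) → Fin (suc n)
  F zero    = zero
  F (suc i) = suc (f i)

  F-inj : Injective _≡_ _≡_ F
  F-inj {zero}  {zero}  _     = refl
  F-inj {suc i} {suc j} Fi≡Fj = cong suc (f-inj (suc-injective Fi≡Fj))

  F-clique : ∀ i j → i ≢ j → a (F i) (F j) ≡ true
  F-clique zero    zero    0≢0 = contradiction refl 0≢0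
  F-clique zero    (suc j) _   = zero~ (f j)
  F-clique (suc i) zero    _   = ~zero (f i)
  F-clique (suc i) (suc j) i≢j = f-clique i j (i≢j ∘ cong suc)

cone : ∀ {n} → Graph n → Graph (suc n)
cone {n} G = record { adj = a ; sym = a-sym ; irrefl = a-irrefl }
  where
  a : Fin (suc n) → Fin (suc n) → Bool
  a zero    zero    = false
  a zero    (suc _) = true
  a (suc _) zero    = true
  a (suc i) (suc j) = adj G i j

  a-sym : ∀ i j → a i j ≡ a j i
  a-sym zero    zero    = refl
  a-sym zero    (suc _) = refl
  a-sym (suc _) zero    = refl
  a-sym (suc i) (suc j) = Graph.sym G i j

  a-irrefl : ∀ i → a i i ≡ false
  a-irrefl zero    = refl
  a-irrefl (suc i) = irrefl G i

cone-saturated : ∀ {n r} (G : Graph n) → Saturated r G → Saturated (suc r) (cone G)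
cone-saturated {r = r} G (no-clique , adding-creates-clique) =
  no-clique ∘ deleteZero-clique (adj (cone G)) , adding-creates-clique′
  where
  adding-creates-clique′ : ∀ u v → u ≢ v → adj (cone G) u v ≡ false →
    HasCliqueRel (addEdgeAdj (cone G) u v) (suc r)
  adding-creates-clique′ zero    zero    0≢0 _  = contradiction refl 0≢0
  adding-creates-clique′ zero    (suc _) _   ()
  adding-creates-clique′ (suc _) zero    _   ()
  adding-creates-clique′ (suc u) (suc v) u≢v uv = apex-clique (addEdgeAdj (cone G) (suc u) (suc v)) (λ _ → refl) (λ _ → refl)
    (adding-creates-clique u v (u≢v ∘ cong suc) uv)

cone-minDegree : ∀ {n t} (G : Graph n) → MinDegree G t → MinDegree (cone G) (suc t)
cone-minDegree {n} {t} G (t≤deg , i , deg-i≡t) = suc-t≤deg , suc i , cong suc deg-i≡t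
  where
  t<n : t < n
  t<n = subst (_< n) deg-i≡t (count<n (adj G i) i (irrefl G i))

  suc-t≤deg : ∀ j → suc t ≤ deg (cone G) j
  suc-t≤deg zero    = subst (suc t ≤_) (sym (count-true n)) t<n
  suc-t≤deg (suc j) = s≤s (t≤deg j)

edges-cone : ∀ {n} (G : Graph n) → edges (cone G) ≡ n + edges G
edges-cone {n} G = cong (_+ edges G) (count-true n)

cone-deficiency : ∀ {n} t (G : Graph n) →
  deficiency (suc t) (cone G) ≡ deficiency t G +ℤ + suc t
cone-deficiency {n} t G = begin
    + (suc t * suc n) - + edges (cone G)
  ≡⟨ cong₂ (λ v e → + v - + e) (order-term t n) (edges-cone G) ⟩
    + ((t * n + suc t) + n) - + (n + edges G)
  ≡⟨ apex-cancels (+ (t * n)) (+ suc t) (+ n) (+ edges G) ⟩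
    (+ (t * n) - + edges G) +ℤ + suc t
  ∎
  where
  open ≡-Reasoning

  order-term : ∀ t n → suc t * suc n ≡ (t * n + suc t) + n
  order-term = ℕ-Solver.solve-∀

  apex-cancels : ∀ tn t+1 n e → ((tn +ℤ t+1) +ℤ n) - (n +ℤ e) ≡ (tn - e) +ℤ t+1
  apex-cancels = ℤ-Solver.solve-∀

cone^ : ∀ {n} s → Graph n → Graph (s + n)
cone^ zero    G = G
cone^ (suc s) G = cone (cone^ s G)

cone^-saturated : ∀ {n r} s (G : Graph n) → Saturated r G → Saturated (s + r) (cone^ s G)
cone^-saturated zero    G sat = sat
cone^-saturated (suc s) G sat = cone-saturated (cone^ s G) (cone^-saturated s G sat)

cone^-minDegree : ∀ {n t} s (G : Graph n) → MinDegree G t → MinDegree (cone^ s G) (s + t)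
cone^-minDegree zero    G δ = δ
cone^-minDegree (suc s) G δ = cone-minDegree (cone^ s G) (cone^-minDegree s G δ)

[s+2]C2≡[s+1]C2+[s+1] : ∀ s → (suc s + 1) C 2 ≡ (s + 1) C 2 + suc s
[s+2]C2≡[s+1]C2+[s+1] s = begin
    suc (s + 1) C 2
  ≡⟨ sym (nCk+nC[k+1]≡[n+1]C[k+1] (s + 1) 1) ⟩
    (s + 1) C 1 + (s + 1) C 2
  ≡⟨ cong (_+ (s + 1) C 2) (nC1≡n (s + 1)) ⟩
    (s + 1) + (s + 1) C 2
  ≡⟨ ℕ.+-comm (s + 1) _ ⟩
    (s + 1) C 2 + (s + 1)
  ≡⟨ cong (_+_ ((s + 1) C 2)) (ℕ.+-comm s 1) ⟩
    (s + 1) C 2 + suc s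
  ∎
  where open ≡-Reasoning

cone^-deficiency : ∀ {n} t s (G : Graph n) →
  deficiency (s + t) (cone^ s G) ≡ deficiency t G +ℤ + (t * s) +ℤ + ((s + 1) C 2)
cone^-deficiency t zero G = sym (begin
    D +ℤ + (t * 0) +ℤ + 0
  ≡⟨ ℤ.+-identityʳ _ ⟩
    D +ℤ + (t * 0)
  ≡⟨ cong (λ k → D +ℤ + k) (ℕ.*-zeroʳ t) ⟩
    D +ℤ + 0
  ≡⟨ ℤ.+-identityʳ D ⟩
    D
  ∎)
  where
  open ≡-Reasoning
  D = deficiency t G
cone^-deficiency t (suc s) G = begin
    deficiency (suc (s + t)) (cone H)
  ≡⟨ cone-deficiency (s + t) H ⟩
    deficiency (s + t) H +ℤ + suc (s + t)
  ≡⟨ cong (_+ℤ + suc (s + t)) (cone^-deficiency t s G) ⟩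
    (D +ℤ + (t * s) +ℤ + c) +ℤ + suc (s + t)
  ≡⟨ ℤ.+-assoc (D +ℤ + (t * s)) (+ c) _ ⟩
    D +ℤ + (t * s) +ℤ + (c + suc (s + t))
  ≡⟨ ℤ.+-assoc D _ _ ⟩
    D +ℤ + (t * s + (c + suc (s + t)))
  ≡⟨ cong (λ k → D +ℤ + k) gain ⟩
    D +ℤ + (t * suc s + (suc s + 1) C 2)
  ≡⟨ sym (ℤ.+-assoc D _ _) ⟩
    D +ℤ + (t * suc s) +ℤ + ((suc s + 1) C 2)
  ∎
  where
  open ≡-Reasoning
  H = cone^ s G
  D = deficiency t G
  c = (s + 1) C 2

  regroup : ∀ t s c → t * s + (c + suc (s + t)) ≡ t * suc s + (c + suc s)
  regroup = ℕ-Solver.solve-∀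

  gain : t * s + (c + suc (s + t)) ≡ t * suc s + (suc s + 1) C 2
  gain = trans (regroup t s c) (cong (_+_ (t * suc s)) (sym ([s+2]C2≡[s+1]C2+[s+1] s)))

lemma1 : (r t s : ℕ) → 3 ≤ r → r ∸ 2 ≤ t →
    (n : ℕ) (G : Graph n) → Saturated r G → MinDegree G t →
    Σ ℕ λ m → Σ (Graph m) λ H → Saturated (r + s) H × MinDegree H (t + s) ×
      (deficiency t G +ℤ + (t * s) +ℤ + ((s + 1) C 2) ≤ℤ deficiency (t + s) H)
lemma1 r t s _ _ n G sat δ rewrite ℕ.+-comm r s | ℕ.+-comm t s =
  s + n , cone^ s G , cone^-saturated s G sat , cone^-minDegree s G δ ,
  ℤ.≤-reflexive (sym (cone^-deficiency t s G))
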